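{- Let $H$ be a finite group and let $K,L$ be Cayley objects over $H$. If $\mathrm{Aut}(K)\prec_{H_R}\mathrm{Aut}(L)$, then every solving set for $K$ is a solving set for $L$. In particular, if $K$ is a CI-object over $H$, then so is $L$.
   Context: Permutations act on the right and compose left to right; for $X\le\mathrm{Sym}(\Omega)$ and $g\in\mathrm{Sym}(\Omega)$, $X^g=g^{ -1}Xg$. $H_R\le\mathrm{Sym}(H)$ is the group of right translations $x\mapsto xh$, $h\in H$. A combinatorial object on $H$ (e.g. a relational structure, colored digraph, or linear code in $\mathbb{F}_q^H$) is acted upon by $\mathrm{Sym}(H)$, $K\mapsto K^g$; $\mathrm{Aut}(K)=\{g:K^g=K\}$, and a Cayley object over $H$ is an object with $H_R\le\mathrm{Aut}(K)$. A set $S\subseteq\mathrm{Sym}(H)$ is a solving set for a Cayley object $K$ if every Cayley object $K'$ over $H$ with $K'=K^g$ for some $g\in\mathrm{Sym}(H)$ satisfies $K'=K^s$ for some $s\in S$; $K$ is a CI-object if every such $K'$ satisfies $K'=K^\sigma$ for some group automorphism $\sigma\in\mathrm{Aut}(H)$ (viewed as a permutation of $H$). For subgroups $X\le Y\le Z\le\mathrm{Sym}(\Omega)$, $Y$ controls fusion of $X$ in $Z$, written $Y\prec_X Z$, if for every $g\in\mathrm{Sym}(\Omega)$ with $X^g\le Z$ there exists $z\in Z$ with $X^{gz}\le Y$. -}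

module Defs where

open import Data.Nat using (ℕ)
open import Data.Fin using (Fin)
open import Data.Fin.Permutation using (Permutation′; _⟨$⟩ʳ_; _∘ₚ_; flip; id; _≈_)
open import Data.Product using (Σ; ∃; _×_)
open import Relation.Binary.PropositionalEquality using (_≡_)
open import Algebra.Structures using (IsGroup)

-- A finite group H, given (up to isomorphism) on the carrier Fin n,
-- with propositional equality.
record FiniteGroup : Set where
  field
    n       : ℕ
    _∙_     : Fin n → Fin n → Fin n
    ε       : Fin n
    _⁻¹     : Fin n → Fin n
    isGroup : IsGroup _≡_ _∙_ ε _⁻¹

-- Sym(H) : permutations of the carrier.  Composition g ∘ₚ h means
-- "first g, then h" (left-to-right), matching the right-action convention.
Sym : FiniteGroup → Set
Sym H = Permutation′ (FiniteGroup.n H)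

app : {H : FiniteGroup} → Sym H → Fin (FiniteGroup.n H) → Fin (FiniteGroup.n H)
app {H} g x = _⟨$⟩ʳ_ {FiniteGroup.n H} {FiniteGroup.n H} g x

_·_ : {H : FiniteGroup} → Sym H → Sym H → Sym H
_·_ {H} g h = _∘ₚ_ {FiniteGroup.n H} {FiniteGroup.n H} {FiniteGroup.n H} g h

inv : {H : FiniteGroup} → Sym H → Sym H
inv {H} g = flip {FiniteGroup.n H} {FiniteGroup.n H} g

one : (H : FiniteGroup) → Sym H
one H = id {FiniteGroup.n H}

_≈ₚ_ : {H : FiniteGroup} → Sym H → Sym H → Set
_≈ₚ_ {H} g h = _≈_ {FiniteGroup.n H} {FiniteGroup.n H} g h

-- Subsets of Sym(H) (subgroups are represented by their membership predicates)
PermSet : FiniteGroup → Set₁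
PermSet H = Sym H → Set

_⊆ₚ_ : {H : FiniteGroup} → PermSet H → PermSet H → Set
X ⊆ₚ Y = ∀ x → X x → Y x

conj : {H : FiniteGroup} → Sym H → Sym H → Sym H
conj {H} x g = _·_ {H} (inv {H} g) (_·_ {H} x g)

ConjSub : {H : FiniteGroup} → PermSet H → Sym H → PermSet H → Set
ConjSub {H} X g Y = ∀ x → X x → Y (conj {H} x g)

RightReg : (H : FiniteGroup) → PermSet H
RightReg H g = Σ (Fin n) λ h → ∀ x → app {H} g x ≡ (x ∙ h)
  where open FiniteGroup H

IsGroupAut : (H : FiniteGroup) → PermSet H
IsGroupAut H σ = ∀ x y → app {H} σ (x ∙ y) ≡ (app {H} σ x ∙ app {H} σ y)
  where open FiniteGroup H

-- Y controls fusion of X in Z  (Y ≺_X Z), for X ≤ Y ≤ Z.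
-- The containments X ≤ Y ≤ Z are part of the notion.
ControlsFusion : {H : FiniteGroup} → (X Y Z : PermSet H) → Set
ControlsFusion {H} X Y Z =
  (_⊆ₚ_ {H} X Y) × (_⊆ₚ_ {H} Y Z) ×
  (∀ (g : Sym H) → ConjSub {H} X g Z →
     Σ (Sym H) λ z → Z z × ConjSub {H} X (_·_ {H} g z) Y)

record Objects (H : FiniteGroup) : Set₁ where
  field
    Obj      : Set
    _^_      : Obj → Sym H → Obj
    act-id   : ∀ K → K ^ one H ≡ K
    act-comp : ∀ K g h → K ^ (_·_ {H} g h) ≡ (K ^ g) ^ h
    act-cong : ∀ K g h → _≈ₚ_ {H} g h → K ^ g ≡ K ^ h

module _ {H : FiniteGroup} (𝒪 : Objects H) where
  open Objects 𝒪

  Aut : Obj → PermSet H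
  Aut K g = K ^ g ≡ K

  IsCayley : Obj → Set
  IsCayley K = _⊆ₚ_ {H} (RightReg H) (Aut K)

  IsSolvingSet : PermSet H → Obj → Set
  IsSolvingSet S K = ∀ K′ → IsCayley K′ → (Σ (Sym H) λ g → K′ ≡ K ^ g) →
                       Σ (Sym H) λ s → S s × K′ ≡ K ^ s

  IsCIObject : Obj → Set
  IsCIObject K = ∀ K′ → IsCayley K′ → (Σ (Sym H) λ g → K′ ≡ K ^ g) →
                   Σ (Sym H) λ σ → IsGroupAut H σ × K′ ≡ K ^ σ

-- Write H_R for the right regular group. If L′ = L^g is a Cayley object, then
-- H_R^(g⁻¹) ≤ Aut(L), and fusion control yields z ∈ Aut(L) with H_R^h ≤ Aut(K)
-- for h = g⁻¹z. Hence K^(h⁻¹) is a Cayley object isomorphic to K, so a solving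
-- set S for K gives s ∈ S with K^(h⁻¹) = K^s, i.e. sh ∈ Aut(K) ≤ Aut(L). Then
-- L^s = L^(h⁻¹) = L^(z⁻¹g) = L^g = L′. A CI-object is exactly an object for
-- which Aut(H) is a solving set.
module Submission where

open import Defs
open import Data.Product using (_×_; _,_)
open import Data.Fin.Permutation using (inverseˡ)
open import Relation.Binary.PropositionalEquality
  using (_≡_; refl; sym; trans; cong; subst; module ≡-Reasoning)

module _ {H : FiniteGroup} (𝒪 : Objects H) where
  open Objects 𝒪
  open ≡-Reasoning

  infixl 7 _⋆_
  _⋆_ : Sym H → Sym H → Sym H
  _⋆_ = _·_ {H}

  ⋆-cancelˡ : (g z : Sym H) → _≈ₚ_ {H} (g ⋆ (inv {H} g ⋆ z)) z
  ⋆-cancelˡ g z i = cong (app {H} z) (inverseˡ g)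

  ^-inverseʳ : ∀ K g → (K ^ g) ^ inv {H} g ≡ K
  ^-inverseʳ K g = begin
    (K ^ g) ^ inv {H} g  ≡⟨ act-comp K g (inv {H} g) ⟨
    K ^ (g ⋆ inv {H} g)  ≡⟨ act-cong K _ (one H) (λ _ → inverseˡ g) ⟩
    K ^ one H            ≡⟨ act-id K ⟩
    K                    ∎

  Aut-resp-≈ : ∀ K {g h} → _≈ₚ_ {H} g h → Aut 𝒪 K g → Aut 𝒪 K h
  Aut-resp-≈ K {g} {h} g≈h g∈Aut = trans (act-cong K h g (λ i → sym (g≈h i))) g∈Aut

  Aut⇒^-≡ : ∀ K a b → Aut 𝒪 K (a ⋆ b) → K ^ a ≡ K ^ inv {H} b
  Aut⇒^-≡ K a b ab∈Aut = begin
    K ^ a                      ≡⟨ ^-inverseʳ (K ^ a) b ⟨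
    ((K ^ a) ^ b) ^ inv {H} b  ≡⟨ cong (_^ inv {H} b) (act-comp K a b) ⟨
    (K ^ (a ⋆ b)) ^ inv {H} b  ≡⟨ cong (_^ inv {H} b) ab∈Aut ⟩
    K ^ inv {H} b              ∎

  ^-≡⇒Aut : ∀ K a b → K ^ a ≡ K ^ inv {H} b → Aut 𝒪 K (a ⋆ b)
  ^-≡⇒Aut K a b Ka≡Kb⁻¹ = begin
    K ^ (a ⋆ b)          ≡⟨ act-comp K a b ⟩
    (K ^ a) ^ b          ≡⟨ cong (_^ b) Ka≡Kb⁻¹ ⟩
    (K ^ inv {H} b) ^ b  ≡⟨ ^-inverseʳ K (inv {H} b) ⟩
    K                    ∎

  ⊆Aut-^⇒ConjSub : ∀ (X : PermSet H) K g →
    _⊆ₚ_ {H} X (Aut 𝒪 (K ^ g)) → ConjSub {H} X (inv {H} g) (Aut 𝒪 K)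
  ⊆Aut-^⇒ConjSub X K g X⊆Aut x x∈X = begin
    K ^ (g ⋆ (x ⋆ g⁻¹))  ≡⟨ act-comp K g (x ⋆ g⁻¹) ⟩
    (K ^ g) ^ (x ⋆ g⁻¹)  ≡⟨ act-comp (K ^ g) x g⁻¹ ⟩
    ((K ^ g) ^ x) ^ g⁻¹  ≡⟨ cong (_^ g⁻¹) (X⊆Aut x x∈X) ⟩
    (K ^ g) ^ g⁻¹        ≡⟨ ^-inverseʳ K g ⟩
    K                    ∎
    where g⁻¹ = inv {H} g

  ConjSub⇒⊆Aut-^inv : ∀ (X : PermSet H) K g →
    ConjSub {H} X g (Aut 𝒪 K) → _⊆ₚ_ {H} X (Aut 𝒪 (K ^ inv {H} g))
  ConjSub⇒⊆Aut-^inv X K g Xᵍ⊆Aut x x∈X = begin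
    (K ^ g⁻¹) ^ x                ≡⟨ ^-inverseʳ ((K ^ g⁻¹) ^ x) g ⟨
    (((K ^ g⁻¹) ^ x) ^ g) ^ g⁻¹  ≡⟨ cong (_^ g⁻¹) (act-comp (K ^ g⁻¹) x g) ⟨
    ((K ^ g⁻¹) ^ (x ⋆ g)) ^ g⁻¹  ≡⟨ cong (_^ g⁻¹) (act-comp K g⁻¹ (x ⋆ g)) ⟨
    (K ^ (g⁻¹ ⋆ (x ⋆ g))) ^ g⁻¹  ≡⟨ cong (_^ g⁻¹) (Xᵍ⊆Aut x x∈X) ⟩
    K ^ g⁻¹                      ∎
    where g⁻¹ = inv {H} g

  isSolvingSet-transfer : ∀ S K L →
    ControlsFusion {H} (RightReg H) (Aut 𝒪 K) (Aut 𝒪 L) →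
    IsSolvingSet 𝒪 S K → IsSolvingSet 𝒪 S L
  isSolvingSet-transfer S K L (_ , Aut-K⊆Aut-L , fusion) solvesK L′ cayleyL′ (g , L′≡Lᵍ)
    with fusion (inv {H} g)
           (⊆Aut-^⇒ConjSub (RightReg H) L g (subst (IsCayley 𝒪) L′≡Lᵍ cayleyL′))
  ... | z , z∈AutL , H_Rʰ⊆AutK
    with solvesK (K ^ inv {H} h) (ConjSub⇒⊆Aut-^inv (RightReg H) K h H_Rʰ⊆AutK) (inv {H} h , refl)
    where h = inv {H} g ⋆ z
  ... | s , s∈S , Kʰ⁻¹≡Kˢ = s , s∈S , (begin
    L′             ≡⟨ L′≡Lᵍ ⟩
    L ^ g          ≡⟨ Aut⇒^-≡ L g h (Aut-resp-≈ L (λ i → sym (⋆-cancelˡ g z i)) z∈AutL) ⟩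
    L ^ inv {H} h  ≡⟨ Aut⇒^-≡ L s h (Aut-K⊆Aut-L (s ⋆ h) (^-≡⇒Aut K s h (sym Kʰ⁻¹≡Kˢ))) ⟨
    L ^ s          ∎)
    where h = inv {H} g ⋆ z

theorem3p4 : (H : FiniteGroup) (𝒪 : Objects H) (K L : Objects.Obj 𝒪) →
    IsCayley 𝒪 K → IsCayley 𝒪 L →
    ControlsFusion {H} (RightReg H) (Aut 𝒪 K) (Aut 𝒪 L) →
    ((S : PermSet H) → IsSolvingSet 𝒪 S K → IsSolvingSet 𝒪 S L)
    × (IsCIObject 𝒪 K → IsCIObject 𝒪 L)
theorem3p4 H 𝒪 K L _ _ fusion =
  (λ S → isSolvingSet-transfer 𝒪 S K L fusion) ,
  isSolvingSet-transfer 𝒪 (IsGroupAut H) K L fusion
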